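{- Let $n\ge 2$ and $S'_n=\{(a,b)\in\mathbb{Z}^2: 2^n-2^{n-2}<a,b<2^n,\ |a-b|\ge 2\}$. If $(a,b)\in S'_n$ and $(a,b)$ is fit in $Q_{n+1}$, then there is an index $j\in\{0,\ldots,n\}$ such that $m_j(I_{a+b})=\min\{a,b\}$, where $I_{a+b}\subseteq Q_{n+1}$.
   Context: $Q_{n+1}=\{0,1\}^{n+1}$ is the hypercube graph (binary strings $x_0\ldots x_n$, adjacent iff differing in exactly one digit) with automorphism group $\mathrm{Aut}(Q_{n+1})$; strings are identified with integers $\sum_i x_i2^{n-i}$ and $I_k\subseteq Q_{n+1}$ is the set of strings with value $<k$. For $S\subseteq Q_{n+1}$, $m_j(S)$ is the number of $x\in S$ with $x_j=1$. A pair of positive integers $(a,b)$ with $a+b\le 2^{n+1}$ is fit in $Q_{n+1}$ if there exist $g_1,g_2\in\mathrm{Aut}(Q_{n+1})$ with $g_1(I_a)\cup g_2(I_b)=I_{a+b}$. -}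

module Defs where

open import Data.Nat using (ℕ; zero; suc; _+_; _^_; _<_; _≤_; _<ᵇ_)
open import Data.Bool using (Bool; true; false; if_then_else_; _∧_)
open import Data.Vec using (Vec; []; _∷_; lookup)
open import Data.List using (List; []; _∷_; map; _++_)
open import Data.Nat.ListAction using (sum)
open import Data.Fin using (Fin)
open import Data.Product using (Σ; _×_; _,_)
open import Data.Sum using (_⊎_)
open import Function.Bundles using (_↔_; _⇔_; Inverse)
open import Relation.Binary.PropositionalEquality using (_≡_)

-- Vertices of Q_{n+1}: binary strings x_0 … x_n (true = 1)
Vertex : ℕ → Set
Vertex n = Vec Bool (suc n)

-- integer value of a string, x_0 being the most significant digit
val : ∀ {m} → Vec Bool m → ℕ
val {zero} [] = 0
val {suc m} (b ∷ xs) = (if b then 2 ^ m else 0) + val xs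

hamming : ∀ {m} → Vec Bool m → Vec Bool m → ℕ
hamming [] [] = 0
hamming (true ∷ xs) (true ∷ ys) = hamming xs ys
hamming (false ∷ xs) (false ∷ ys) = hamming xs ys
hamming (true ∷ xs) (false ∷ ys) = suc (hamming xs ys)
hamming (false ∷ xs) (true ∷ ys) = suc (hamming xs ys)

Adj : ∀ {n} → Vertex n → Vertex n → Set
Adj x y = hamming x y ≡ 1

record Aut (n : ℕ) : Set where
  field
    perm     : Vertex n ↔ Vertex n
    preserve : ∀ x y → Adj x y ⇔ Adj (Inverse.to perm x) (Inverse.to perm y)

apply : ∀ {n} → Aut n → Vertex n → Vertex n
apply g = Inverse.to (Aut.perm g)

I : ∀ {n} → ℕ → Vertex n → Set
I k x = val x < k

InImage : ∀ {n} → Aut n → ℕ → Vertex n → Set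
InImage {n} g k y = Σ (Vertex n) λ x → I k x × apply g x ≡ y

Fit : ℕ → ℕ → ℕ → Set
Fit n a b =
  (1 ≤ a) × (1 ≤ b) × (a + b ≤ 2 ^ suc n) ×
  Σ (Aut n) λ g₁ → Σ (Aut n) λ g₂ →
    ∀ (y : Vertex n) → (InImage g₁ a y ⊎ InImage g₂ b y) ⇔ I (a + b) y

allVecs : (m : ℕ) → List (Vec Bool m)
allVecs zero = [] ∷ []
allVecs (suc m) = map (false ∷_) (allVecs m) ++ map (true ∷_) (allVecs m)

mI : (n : ℕ) → ℕ → Fin (suc n) → ℕ
mI n k j = sum (map (λ x → if (val x <ᵇ k) ∧ lookup x j then 1 else 0) (allVecs (suc n)))

-- Since a, b ≤ 2ⁿ, the segments I_a and I_b lie in the facet x₀ = 0. An automorphism of the cube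
-- keeps the edges of direction 0 pairwise parallel (opposite edges of a 4-cycle stay opposite), so it
-- maps that facet into a facet x_j = ε. As a + b > 2ⁿ + 2ⁿ⁻¹, the two facets containing g₁(I_a) and
-- g₂(I_b) can only cover I_{a+b} if they are x_j = ε and x_j = ¬ε; then the images are the two halves
-- of I_{a+b} cut by coordinate j, and m_j(I_{a+b}) is a or b. Flipping bit j maps the ones of an
-- initial segment injectively into its zeros, so m_j(I_{a+b}) is the smaller half, min(a, b).

{-# OPTIONS --safe #-}
module Submission where

open import Defs
open import Data.Nat using (ℕ; zero; suc; _+_; _*_; _∸_; _^_; _<_; _≤_; _⊓_; _<ᵇ_; z≤n; s≤s)
open import Data.Nat.Properties
  using (≤-refl; ≤-reflexive; ≤-trans; <-≤-trans; ≤-<-trans; <⇒≤; <⇒≱; suc-injective; <ᵇ⇒<; <⇒<ᵇ;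
         +-comm; +-assoc; +-identityʳ; +-mono-≤; +-monoˡ-≤; +-monoʳ-≤; +-mono-<; m≤m+n; m≤n+m;
         m∸n≤m; ∸-monoʳ-≤; m+n∸n≡m; ^-monoʳ-≤; m≤n⇒m⊓n≡m; m≥n⇒m⊓n≡n; module ≤-Reasoning)
open import Data.Nat.Tactic.RingSolver using (solve-∀)
open import Data.Bool using (Bool; true; false; if_then_else_; _∧_; not; T)
open import Data.Bool.Properties using (T-∧; T-≡; T-not-≡; not-involutive; not-injective; not-¬)
open import Data.Fin using (Fin; zero; suc; toℕ; _≟_)
open import Data.Vec using (Vec; []; _∷_; lookup; replicate; _[_]%=_; _[_]≔_)
open import Data.Vec.Properties
  using (∷-injectiveʳ; lookup∘updateAt; lookup∘updateAt′; updateAt-updateAt-local; updateAt-id)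
open import Data.List using ([]; _∷_; map; _++_)
import Data.List.Properties as List
open import Data.List.Membership.Propositional using (_∈_)
open import Data.List.Membership.Propositional.Properties using (∈-map⁺; ∈-map⁻; ∈-++⁺ˡ; ∈-++⁺ʳ)
open import Data.List.Membership.Propositional.Properties.WithK using (unique∧set⇒bag)
open import Data.List.Relation.Unary.Any using (here)
open import Data.List.Relation.Unary.All using ([])
open import Data.List.Relation.Unary.Unique.Propositional using (Unique; []; _∷_)
import Data.List.Relation.Unary.Unique.Propositional.Properties as Unique
open import Data.List.Relation.Binary.Permutation.Propositional using (_↭_)
import Data.List.Relation.Binary.Permutation.Propositional.Properties as ↭
open import Data.List.Relation.Binary.BagAndSetEquality using (∼bag⇒↭)
open import Data.Nat.ListAction using (sum)
open import Data.Nat.ListAction.Properties using (sum-↭; sum-++)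
open import Data.Product using (Σ; ∃; _×_; _,_; proj₁; proj₂)
import Data.Product as Product
open import Data.Sum using (_⊎_; inj₁; [_,_])
import Data.Sum as Sum
open import Data.Empty using (⊥-elim)
open import Function using (id; _∘_; _⇔_; _↔_; Inverse; Injection; Equivalence; mk⇔; mk↔ₛ′)
open import Function.Properties.Inverse using (Inverse⇒Injection)
open import Function.Construct.Composition using (_⇔-∘_)
open import Function.Construct.Symmetry using (⇔-sym)
open import Data.Product.Function.NonDependent.Propositional using (_×-⇔_)
open import Relation.Binary.PropositionalEquality
  using (_≡_; _≢_; refl; sym; trans; cong; cong₂; subst; subst₂; ≢-sym; module ≡-Reasoning)
open import Relation.Nullary using (¬_; yes; no)

∈-allVecs : ∀ {m} (x : Vec Bool m) → x ∈ allVecs m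
∈-allVecs [] = here refl
∈-allVecs (false ∷ x) = ∈-++⁺ˡ (∈-map⁺ (false ∷_) (∈-allVecs x))
∈-allVecs (true ∷ x) = ∈-++⁺ʳ _ (∈-map⁺ (true ∷_) (∈-allVecs x))

allVecs-unique : ∀ m → Unique (allVecs m)
allVecs-unique zero = [] ∷ []
allVecs-unique (suc m) =
  Unique.++⁺ (Unique.map⁺ ∷-injectiveʳ u) (Unique.map⁺ ∷-injectiveʳ u) disjoint
  where
  u = allVecs-unique m
  disjoint : ∀ {x} → ¬ (x ∈ map (false ∷_) (allVecs m) × x ∈ map (true ∷_) (allVecs m))
  disjoint (p , q) with ∈-map⁻ (false ∷_) p | ∈-map⁻ (true ∷_) q
  ... | _ , _ , refl | _ , _ , ()

map-allVecs-↭ : ∀ {m} (π : Vec Bool m ↔ Vec Bool m) → map (Inverse.to π) (allVecs m) ↭ allVecs m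
map-allVecs-↭ {m} π = ∼bag⇒↭ (unique∧set⇒bag
  (Unique.map⁺ (Injection.injective (Inverse⇒Injection π)) (allVecs-unique m)) (allVecs-unique m)
  (λ {x} → mk⇔ (λ _ → ∈-allVecs x) (λ _ → x∈image x)))
  where
  x∈image : ∀ x → x ∈ map (Inverse.to π) (allVecs m)
  x∈image x =
    subst (_∈ _) (Inverse.strictlyInverseˡ π x) (∈-map⁺ (Inverse.to π) (∈-allVecs (Inverse.from π x)))

count : (m : ℕ) → (Vec Bool m → Bool) → ℕ
count m p = sum (map (λ x → if p x then 1 else 0) (allVecs m))

count-∘-inverse : ∀ {m} (π : Vec Bool m ↔ Vec Bool m) p → count m (p ∘ Inverse.to π) ≡ count m p
count-∘-inverse {m} π p = begin
  sum (map (indicator ∘ Inverse.to π) (allVecs m))     ≡⟨ cong sum (List.map-∘ (allVecs m)) ⟩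
  sum (map indicator (map (Inverse.to π) (allVecs m))) ≡⟨ sum-↭ (↭.map⁺ indicator (map-allVecs-↭ π)) ⟩
  count m p ∎
  where
  open ≡-Reasoning
  indicator = λ x → if p x then 1 else 0

T⇔T⇒≡ : ∀ {b c} → T b ⇔ T c → b ≡ c
T⇔T⇒≡ {false} {false} _ = refl
T⇔T⇒≡ {true} {true} _ = refl
T⇔T⇒≡ {true} {false} b⇔c = ⊥-elim (Equivalence.to b⇔c _)
T⇔T⇒≡ {false} {true} b⇔c = ⊥-elim (Equivalence.from b⇔c _)

count-cong : ∀ {m} {p q : Vec Bool m → Bool} → (∀ x → p x ≡ q x) → count m p ≡ count m q
count-cong {m} p≗q = cong sum (List.map-cong (λ x → cong (λ b → if b then 1 else 0) (p≗q x)) (allVecs m))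

count-mono : ∀ {m} {p q : Vec Bool m → Bool} → (∀ x → T (p x) → T (q x)) → count m p ≤ count m q
count-mono {m} {p} {q} p⇒q = go (allVecs m)
  where
  indicator-mono : ∀ x → (if p x then 1 else 0) ≤ (if q x then 1 else 0)
  indicator-mono x with p x | q x | p⇒q x
  ... | false | _ | _ = z≤n
  ... | true | true | _ = ≤-refl
  ... | true | false | p⇒q = ⊥-elim (p⇒q _)
  go : ∀ xs → sum (map (λ x → if p x then 1 else 0) xs) ≤ sum (map (λ x → if q x then 1 else 0) xs)
  go [] = z≤n
  go (x ∷ xs) = +-mono-≤ (indicator-mono x) (go xs)

count-suc : ∀ m p → count (suc m) p ≡ count m (p ∘ (false ∷_)) + count m (p ∘ (true ∷_))
count-suc m p = begin
  sum (map indicator (map (false ∷_) A ++ map (true ∷_) A))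
    ≡⟨ cong sum (List.map-++ indicator (map (false ∷_) A) _) ⟩
  sum (map indicator (map (false ∷_) A) ++ map indicator (map (true ∷_) A))
    ≡⟨ sum-++ (map indicator (map (false ∷_) A)) _ ⟩
  sum (map indicator (map (false ∷_) A)) + sum (map indicator (map (true ∷_) A))
    ≡⟨ sym (cong₂ _+_ (cong sum (List.map-∘ A)) (cong sum (List.map-∘ A))) ⟩
  count m (p ∘ (false ∷_)) + count m (p ∘ (true ∷_)) ∎
  where
  open ≡-Reasoning
  A = allVecs m
  indicator = λ x → if p x then 1 else 0

+<ᵇ≡<ᵇ∸ : ∀ m n o → (m + n <ᵇ o) ≡ (n <ᵇ o ∸ m)
+<ᵇ≡<ᵇ∸ zero n o = refl
+<ᵇ≡<ᵇ∸ (suc m) n zero = refl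
+<ᵇ≡<ᵇ∸ (suc m) n (suc o) = +<ᵇ≡<ᵇ∸ m n o

m⊓n+[m∸n]⊓o≡m⊓[n+o] : ∀ m n o → m ⊓ n + (m ∸ n) ⊓ o ≡ m ⊓ (n + o)
m⊓n+[m∸n]⊓o≡m⊓[n+o] zero zero o = refl
m⊓n+[m∸n]⊓o≡m⊓[n+o] zero (suc n) o = refl
m⊓n+[m∸n]⊓o≡m⊓[n+o] (suc m) zero o = refl
m⊓n+[m∸n]⊓o≡m⊓[n+o] (suc m) (suc n) o = cong suc (m⊓n+[m∸n]⊓o≡m⊓[n+o] m n o)

count-val<ᵇ : ∀ m k → count m (λ x → val x <ᵇ k) ≡ k ⊓ 2 ^ m
count-val<ᵇ zero zero = refl
count-val<ᵇ zero (suc zero) = refl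
count-val<ᵇ zero (suc (suc k)) = refl
count-val<ᵇ (suc m) k = begin
  count (suc m) (λ x → val x <ᵇ k)
    ≡⟨ count-suc m (λ x → val x <ᵇ k) ⟩
  count m (λ x → val x <ᵇ k) + count m (λ x → 2 ^ m + val x <ᵇ k)
    ≡⟨ cong₂ _+_ (count-val<ᵇ m k)
                 (count-cong {m} {λ x → 2 ^ m + val x <ᵇ k} (λ x → +<ᵇ≡<ᵇ∸ (2 ^ m) (val x) k)) ⟩
  k ⊓ 2 ^ m + count m (λ x → val x <ᵇ k ∸ 2 ^ m)
    ≡⟨ cong (k ⊓ 2 ^ m +_) (count-val<ᵇ m (k ∸ 2 ^ m)) ⟩
  k ⊓ 2 ^ m + (k ∸ 2 ^ m) ⊓ 2 ^ m
    ≡⟨ m⊓n+[m∸n]⊓o≡m⊓[n+o] k (2 ^ m) (2 ^ m) ⟩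
  k ⊓ (2 ^ m + 2 ^ m)
    ≡⟨ cong (k ⊓_) (cong (2 ^ m +_) (sym (+-identityʳ (2 ^ m)))) ⟩
  k ⊓ 2 ^ suc m ∎
  where open ≡-Reasoning

flip : ∀ {m} → Fin m → Vec Bool m → Vec Bool m
flip i x = x [ i ]%= not

lookup-flip : ∀ {m} (i : Fin m) x → lookup (flip i x) i ≡ not (lookup x i)
lookup-flip i x = lookup∘updateAt i x

lookup-flip′ : ∀ {m} {i j : Fin m} → i ≢ j → ∀ x → lookup (flip i x) j ≡ lookup x j
lookup-flip′ {i = i} {j} i≢j x = lookup∘updateAt′ j i (≢-sym i≢j) x

flip-involutive : ∀ {m} (i : Fin m) x → flip i (flip i x) ≡ x
flip-involutive i x = trans (updateAt-updateAt-local i x (not-involutive (lookup x i))) (updateAt-id i x)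

flip-↔ : ∀ {m} → Fin m → Vec Bool m ↔ Vec Bool m
flip-↔ i = mk↔ₛ′ (flip i) (flip i) (flip-involutive i) (flip-involutive i)

flip-square : ∀ {m} {i p q l : Fin m} x → flip p (flip i x) ≡ flip l (flip q x) → p ≢ i → q ≢ i → l ≡ i
flip-square {i = i} {p} {q} {l} x square p≢i q≢i with l ≟ i
... | yes l≡i = l≡i
... | no l≢i = ⊥-elim (not-¬ refl (begin
    lookup x i                           ≡⟨ lookup-flip′ q≢i x ⟨
    lookup (flip q x) i                  ≡⟨ lookup-flip′ l≢i (flip q x) ⟨
    lookup (flip l (flip q x)) i         ≡⟨ cong (λ y → lookup y i) square ⟨
    lookup (flip p (flip i x)) i         ≡⟨ lookup-flip′ p≢i (flip i x) ⟩
    lookup (flip i x) i                  ≡⟨ lookup-flip i x ⟩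
    not (lookup x i)                     ∎))
  where open ≡-Reasoning

flip-induction : ∀ {m} (P : Vec Bool m → Set) → (∀ x i → P x → P (flip i x)) → ∀ {x} y → P x → P y
flip-induction {zero} P step {[]} [] Px = Px
flip-induction {suc m} P step {b ∷ x} (c ∷ y) Pbx =
  fixHead b c (flip-induction (P ∘ (b ∷_)) (λ z k → step (b ∷ z) (suc k)) y Pbx)
  where
  fixHead : ∀ b c → P (b ∷ y) → P (c ∷ y)
  fixHead false false = id
  fixHead true true = id
  fixHead false true = step (false ∷ y) zero
  fixHead true false = step (true ∷ y) zero

hamming-refl : ∀ {m} (x : Vec Bool m) → hamming x x ≡ 0
hamming-refl [] = refl
hamming-refl (true ∷ x) = hamming-refl x
hamming-refl (false ∷ x) = hamming-refl x

hamming≡0⇒≡ : ∀ {m} {x y : Vec Bool m} → hamming x y ≡ 0 → x ≡ y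
hamming≡0⇒≡ {x = []} {[]} _ = refl
hamming≡0⇒≡ {x = true ∷ x} {true ∷ y} h = cong (true ∷_) (hamming≡0⇒≡ h)
hamming≡0⇒≡ {x = false ∷ x} {false ∷ y} h = cong (false ∷_) (hamming≡0⇒≡ h)

hamming-flip : ∀ {m} (i : Fin m) x → hamming x (flip i x) ≡ 1
hamming-flip zero (true ∷ x) = cong suc (hamming-refl x)
hamming-flip zero (false ∷ x) = cong suc (hamming-refl x)
hamming-flip (suc i) (true ∷ x) = hamming-flip i x
hamming-flip (suc i) (false ∷ x) = hamming-flip i x

hamming≡1⇒flip : ∀ {m} {x y : Vec Bool m} → hamming x y ≡ 1 → ∃ λ i → y ≡ flip i x
hamming≡1⇒flip {x = []} {[]} ()
hamming≡1⇒flip {x = true ∷ x} {true ∷ y} h = Product.map suc (cong (true ∷_)) (hamming≡1⇒flip h)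
hamming≡1⇒flip {x = false ∷ x} {false ∷ y} h = Product.map suc (cong (false ∷_)) (hamming≡1⇒flip h)
hamming≡1⇒flip {x = true ∷ x} {false ∷ y} h = zero , cong (false ∷_) (sym (hamming≡0⇒≡ (suc-injective h)))
hamming≡1⇒flip {x = false ∷ x} {true ∷ y} h = zero , cong (true ∷_) (sym (hamming≡0⇒≡ (suc-injective h)))

module _ {n : ℕ} (g : Aut n) where

  apply-injective : ∀ {x y} → apply g x ≡ apply g y → x ≡ y
  apply-injective = Injection.injective (Inverse⇒Injection (Aut.perm g))

  apply-flip : ∀ x i → ∃ λ k → apply g (flip i x) ≡ flip k (apply g x)
  apply-flip x i = hamming≡1⇒flip (Equivalence.to (Aut.preserve g x (flip i x)) (hamming-flip i x))

  private
    lower upper : Vec Bool n → Vertex n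
    lower xs = apply g (false ∷ xs)
    upper xs = apply g (true ∷ xs)

  rungDirection : Fin (suc n)
  rungDirection = proj₁ (apply-flip (false ∷ replicate n false) zero)

  Rung : Vec Bool n → Set
  Rung xs = upper xs ≡ flip rungDirection (lower xs)

  lower-step≢rungDirection : ∀ {xs ys k} → Rung xs → lower ys ≡ flip k (lower xs) → k ≢ rungDirection
  lower-step≢rungDirection rung step refl with () ← apply-injective (trans step (sym rung))

  upper-step≢rungDirection : ∀ {xs ys k} → Rung xs → upper ys ≡ flip k (upper xs) → k ≢ rungDirection
  upper-step≢rungDirection {xs} rung step refl
    with () ← apply-injective (trans step (trans (cong (flip rungDirection) rung) (flip-involutive _ (lower xs))))

  -- 0xs, 1xs, 1xs′, 0xs′ (xs′ = flip k xs) is a 4-cycle, so its image is one with parallel opposite edges.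
  rung-flip : ∀ xs k → Rung xs → Rung (flip k xs)
  rung-flip xs k rung
    with apply-flip (false ∷ xs) (suc k) | apply-flip (true ∷ xs) (suc k) | apply-flip (false ∷ flip k xs) zero
  ... | q , lower-step | p , upper-step | l , rung′ =
    subst (λ j → upper (flip k xs) ≡ flip j (lower (flip k xs))) l≡j rung′
    where
    l≡j : l ≡ rungDirection
    l≡j = flip-square (lower xs)
      (trans (cong (flip p) (sym rung)) (trans (sym upper-step) (trans rung′ (cong (flip l) lower-step))))
      (upper-step≢rungDirection rung upper-step) (lower-step≢rungDirection rung lower-step)

  rungs : ∀ xs → Rung xs
  rungs xs = flip-induction Rung rung-flip xs (proj₂ (apply-flip (false ∷ replicate n false) zero))

  facetBit : Bool
  facetBit = lookup (lower (replicate n false)) rungDirection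

  lower-facet : ∀ xs → lookup (lower xs) rungDirection ≡ facetBit
  lower-facet xs = flip-induction (λ ys → lookup (lower ys) rungDirection ≡ facetBit) step xs refl
    where
    step : ∀ ys k → lookup (lower ys) rungDirection ≡ facetBit →
                    lookup (lower (flip k ys)) rungDirection ≡ facetBit
    step ys k facet with q , lower-step ← apply-flip (false ∷ ys) (suc k) = begin
      lookup (lower (flip k ys)) rungDirection  ≡⟨ cong (λ y → lookup y rungDirection) lower-step ⟩
      lookup (flip q (lower ys)) rungDirection  ≡⟨ lookup-flip′ q≢rungDirection (lower ys) ⟩
      lookup (lower ys) rungDirection           ≡⟨ facet ⟩
      facetBit                                  ∎
      where
      open ≡-Reasoning
      q≢rungDirection = lower-step≢rungDirection (rungs ys) lower-step

image⊆facet : ∀ {n a} (g : Aut n) → a ≤ 2 ^ n →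
  Σ (Fin (suc n)) λ j → Σ Bool λ ε → ∀ y → InImage g a y → lookup y j ≡ ε
image⊆facet {n} g a≤2ⁿ = rungDirection g , facetBit g , inFacet
  where
  inFacet : ∀ y → InImage g _ y → lookup y (rungDirection g) ≡ facetBit g
  inFacet y (false ∷ xs , _ , refl) = lower-facet g xs
  inFacet y (true ∷ xs , x<a , _) = ⊥-elim (<⇒≱ (<-≤-trans x<a a≤2ⁿ) (m≤m+n (2 ^ n) (val xs)))

val-≔ : ∀ {m} (x : Vec Bool m) i b → val (x [ i ]≔ b) ≤ val x + 2 ^ (m ∸ suc (toℕ i))
val-≔ {suc m} (c ∷ x) zero b = begin
  (if b then 2 ^ m else 0) + val x   ≤⟨ +-monoˡ-≤ (val x) (digit≤ b) ⟩
  2 ^ m + val x                      ≡⟨ +-comm (2 ^ m) (val x) ⟩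
  val x + 2 ^ m                      ≤⟨ +-monoˡ-≤ (2 ^ m) (m≤n+m (val x) _) ⟩
  (if c then 2 ^ m else 0) + val x + 2 ^ m ∎
  where
  open ≤-Reasoning
  digit≤ : ∀ b → (if b then 2 ^ m else 0) ≤ 2 ^ m
  digit≤ true = ≤-refl
  digit≤ false = z≤n
val-≔ {suc m} (c ∷ x) (suc i) b = begin
  digit + val (x [ i ]≔ b)                 ≤⟨ +-monoʳ-≤ digit (val-≔ x i b) ⟩
  digit + (val x + 2 ^ (m ∸ suc (toℕ i)))  ≡⟨ +-assoc digit (val x) _ ⟨
  digit + val x + 2 ^ (m ∸ suc (toℕ i))    ∎
  where
  open ≤-Reasoning
  digit = if c then 2 ^ m else 0

val-replicate-false : ∀ m → val (replicate m false) ≡ 0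
val-replicate-false zero = refl
val-replicate-false (suc m) = val-replicate-false m

val-flip-false : ∀ {m} (i : Fin m) x → lookup x i ≡ false → val x ≤ val (flip i x)
val-flip-false {suc m} zero (false ∷ x) _ = m≤n+m (val x) (2 ^ m)
val-flip-false {suc m} (suc i) (b ∷ x) xᵢ≡false = +-monoʳ-≤ (if b then 2 ^ m else 0) (val-flip-false i x xᵢ≡false)

2^[n∸i]+2^[n∸j]≤2^n+2^[n∸1] : ∀ n {i j : Fin (suc n)} → i ≢ j →
  2 ^ (n ∸ toℕ i) + 2 ^ (n ∸ toℕ j) ≤ 2 ^ n + 2 ^ (n ∸ 1)
2^[n∸i]+2^[n∸j]≤2^n+2^[n∸1] n {zero} {zero} 0≢0 = ⊥-elim (0≢0 refl)
2^[n∸i]+2^[n∸j]≤2^n+2^[n∸1] n {zero} {suc j} _ = +-monoʳ-≤ (2 ^ n) (^-monoʳ-≤ 2 (∸-monoʳ-≤ n (s≤s z≤n)))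
2^[n∸i]+2^[n∸j]≤2^n+2^[n∸1] n {suc i} {j} _ = begin
  2 ^ (n ∸ suc (toℕ i)) + 2 ^ (n ∸ toℕ j)   ≡⟨ +-comm (2 ^ (n ∸ suc (toℕ i))) _ ⟩
  2 ^ (n ∸ toℕ j) + 2 ^ (n ∸ suc (toℕ i))   ≤⟨ +-mono-≤ (^-monoʳ-≤ 2 (m∸n≤m n (toℕ j)))
                                                        (^-monoʳ-≤ 2 (∸-monoʳ-≤ n (s≤s z≤n))) ⟩
  2 ^ n + 2 ^ (n ∸ 1)                       ∎
  where open ≤-Reasoning

segment⊆facets⇒complementary : ∀ {n k} {i j : Fin (suc n)} {ε δ} → 2 ^ n + 2 ^ (n ∸ 1) < k →
  (∀ (y : Vertex n) → I k y → lookup y i ≡ ε ⊎ lookup y j ≡ δ) → i ≡ j × δ ≡ not ε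
segment⊆facets⇒complementary {n} {k} {i} {j} {ε} {δ} long covered with i ≟ j
... | yes refl =
  refl , [ (λ yᵢ≡ε → ⊥-elim (not-¬ yᵢ≡ε yᵢ≡not-ε)) , (λ yᵢ≡δ → trans (sym yᵢ≡δ) yᵢ≡not-ε) ] (covered y y<k)
  where
  y = replicate (suc n) false [ i ]≔ not ε
  yᵢ≡not-ε : lookup y i ≡ not ε
  yᵢ≡not-ε = lookup∘updateAt i (replicate (suc n) false)
  y<k : val y < k
  y<k = begin-strict
    val y                                            ≤⟨ val-≔ (replicate (suc n) false) i (not ε) ⟩
    val (replicate (suc n) false) + 2 ^ (n ∸ toℕ i)  ≡⟨ cong (_+ 2 ^ (n ∸ toℕ i)) (val-replicate-false (suc n)) ⟩
    2 ^ (n ∸ toℕ i)                                  ≤⟨ ^-monoʳ-≤ 2 (m∸n≤m n (toℕ i)) ⟩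
    2 ^ n                                            ≤⟨ m≤m+n (2 ^ n) _ ⟩
    2 ^ n + 2 ^ (n ∸ 1)                              <⟨ long ⟩
    k                                                ∎
    where open ≤-Reasoning
... | no i≢j =
  ⊥-elim ([ (λ yᵢ≡ε → not-¬ yᵢ≡ε yᵢ≡not-ε) , (λ yⱼ≡δ → not-¬ yⱼ≡δ yⱼ≡not-δ) ] (covered y y<k))
  where
  z = replicate (suc n) false [ j ]≔ not δ
  y = z [ i ]≔ not ε
  yᵢ≡not-ε : lookup y i ≡ not ε
  yᵢ≡not-ε = lookup∘updateAt i z
  yⱼ≡not-δ : lookup y j ≡ not δ
  yⱼ≡not-δ = trans (lookup∘updateAt′ j i (≢-sym i≢j) z) (lookup∘updateAt j (replicate (suc n) false))
  y<k : val y < k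
  y<k = begin-strict
    val y                                        ≤⟨ val-≔ z i (not ε) ⟩
    val z + 2 ^ (n ∸ toℕ i)                      ≤⟨ +-monoˡ-≤ _ (val-≔ (replicate (suc n) false) j (not δ)) ⟩
    val (replicate (suc n) false) + 2 ^ (n ∸ toℕ j) + 2 ^ (n ∸ toℕ i)
             ≡⟨ cong (λ v → v + 2 ^ (n ∸ toℕ j) + 2 ^ (n ∸ toℕ i)) (val-replicate-false (suc n)) ⟩
    2 ^ (n ∸ toℕ j) + 2 ^ (n ∸ toℕ i)            ≤⟨ 2^[n∸i]+2^[n∸j]≤2^n+2^[n∸1] n (≢-sym i≢j) ⟩
    2 ^ n + 2 ^ (n ∸ 1)                          <⟨ long ⟩
    k                                            ∎
    where open ≤-Reasoning

-- With ε = true this is definitionally the predicate counted by mI.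
segmentFacet : ∀ {m} → ℕ → Fin m → Bool → Vec Bool m → Bool
segmentFacet k j ε y = (val y <ᵇ k) ∧ (if ε then lookup y j else not (lookup y j))

T-segmentFacet : ∀ {m} k (j : Fin m) ε y → T (segmentFacet k j ε y) ⇔ (val y < k × lookup y j ≡ ε)
T-segmentFacet k j ε y = (mk⇔ (<ᵇ⇒< (val y) k) <⇒<ᵇ ×-⇔ T-bit ε) ⇔-∘ T-∧
  where
  T-bit : ∀ ε → T (if ε then lookup y j else not (lookup y j)) ⇔ (lookup y j ≡ ε)
  T-bit true = T-≡
  T-bit false = T-not-≡

count-ones≤count-zeros : ∀ {m} k (j : Fin m) → count m (segmentFacet k j true) ≤ count m (segmentFacet k j false)
count-ones≤count-zeros {m} k j = begin
  count m (segmentFacet k j true)            ≡⟨ count-∘-inverse (flip-↔ j) (segmentFacet k j true) ⟨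
  count m (segmentFacet k j true ∘ flip j)   ≤⟨ count-mono flipped-one⇒zero ⟩
  count m (segmentFacet k j false)           ∎
  where
  open ≤-Reasoning
  flipped-one⇒zero : ∀ y → T (segmentFacet k j true (flip j y)) → T (segmentFacet k j false y)
  flipped-one⇒zero y t with flip-y<k , flip-yⱼ≡true ← Equivalence.to (T-segmentFacet k j true (flip j y)) t =
    Equivalence.from (T-segmentFacet k j false y) (≤-<-trans (val-flip-false j y yⱼ≡false) flip-y<k , yⱼ≡false)
    where
    yⱼ≡false : lookup y j ≡ false
    yⱼ≡false = not-injective (trans (sym (lookup-flip j y)) flip-yⱼ≡true)

count-image : ∀ {n a} (g : Aut n) (p : Vertex n → Bool) → a ≤ 2 ^ suc n →
  (∀ y → InImage g a y ⇔ T (p y)) → count (suc n) p ≡ a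
count-image {n} {a} g p a≤2ⁿ⁺¹ image⇔p = begin
  count (suc n) p                    ≡⟨ count-∘-inverse (Aut.perm g) p ⟨
  count (suc n) (p ∘ apply g)        ≡⟨ count-cong (λ x → T⇔T⇒≡ (p∘g⇔x<a x)) ⟩
  count (suc n) (λ x → val x <ᵇ a)   ≡⟨ count-val<ᵇ (suc n) a ⟩
  a ⊓ 2 ^ suc n                      ≡⟨ m≤n⇒m⊓n≡m a≤2ⁿ⁺¹ ⟩
  a                                  ∎
  where
  open ≡-Reasoning
  p∘g⇔x<a : ∀ x → T (p (apply g x)) ⇔ T (val x <ᵇ a)
  p∘g⇔x<a x = mk⇔ p∘g⇒x<a (λ x<a → Equivalence.to (image⇔p (apply g x)) (x , <ᵇ⇒< (val x) a x<a , refl))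
    where
    p∘g⇒x<a : T (p (apply g x)) → T (val x <ᵇ a)
    p∘g⇒x<a t with x′ , x′<a , gx′≡gx ← Equivalence.from (image⇔p (apply g x)) t =
      <⇒<ᵇ (subst (λ z → val z < a) (apply-injective g gx′≡gx) x′<a)

UnionOfImages : ∀ {n} → Aut n → ℕ → Aut n → ℕ → ℕ → Set
UnionOfImages {n} g₁ a g₂ b k = ∀ (y : Vertex n) → (InImage g₁ a y ⊎ InImage g₂ b y) ⇔ I k y

UnionOfImages-swap : ∀ {n a b k} (g₁ g₂ : Aut n) → UnionOfImages g₁ a g₂ b k → UnionOfImages g₂ b g₁ a k
UnionOfImages-swap g₁ g₂ union y = mk⇔ (Equivalence.to (union y) ∘ Sum.swap) (Sum.swap ∘ Equivalence.from (union y))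

count-segmentFacet : ∀ {n a b k} (g₁ g₂ : Aut n) {j ε} → UnionOfImages g₁ a g₂ b k →
  (∀ y → InImage g₁ a y → lookup y j ≡ ε) → (∀ y → InImage g₂ b y → lookup y j ≡ not ε) →
  a ≤ 2 ^ suc n → count (suc n) (segmentFacet k j ε) ≡ a
count-segmentFacet {k = k} g₁ g₂ {j} {ε} union g₁⊆facet g₂⊆facetᶜ a≤2ⁿ⁺¹ =
  count-image g₁ (segmentFacet k j ε) a≤2ⁿ⁺¹
    (λ y → ⇔-sym (T-segmentFacet k j ε y) ⇔-∘ image⇔segment∩facet y)
  where
  image⇔segment∩facet : ∀ y → InImage g₁ _ y ⇔ (val y < k × lookup y j ≡ ε)
  image⇔segment∩facet y = mk⇔
    (λ y∈g₁ → Equivalence.to (union y) (inj₁ y∈g₁) , g₁⊆facet y y∈g₁)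
    (λ (y<k , yⱼ≡ε) → [ (λ y∈g₁ → y∈g₁) , (λ y∈g₂ → ⊥-elim (not-¬ yⱼ≡ε (g₂⊆facetᶜ y y∈g₂))) ]
                        (Equivalence.from (union y) y<k))

mI≡⊓ : ∀ {n a b} (g₁ g₂ : Aut n) j ε → UnionOfImages g₁ a g₂ b (a + b) →
  (∀ y → InImage g₁ a y → lookup y j ≡ ε) → (∀ y → InImage g₂ b y → lookup y j ≡ not ε) →
  a ≤ 2 ^ suc n → b ≤ 2 ^ suc n → mI n (a + b) j ≡ a ⊓ b
mI≡⊓ {a = a} {b} g₁ g₂ j true union g₁⊆facet g₂⊆facetᶜ a≤2ⁿ⁺¹ b≤2ⁿ⁺¹ =
  trans ones≡a (sym (m≤n⇒m⊓n≡m (subst₂ _≤_ ones≡a zeros≡b (count-ones≤count-zeros (a + b) j))))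
  where
  ones≡a : count _ (segmentFacet (a + b) j true) ≡ a
  ones≡a = count-segmentFacet g₁ g₂ union g₁⊆facet g₂⊆facetᶜ a≤2ⁿ⁺¹
  zeros≡b : count _ (segmentFacet (a + b) j false) ≡ b
  zeros≡b = count-segmentFacet g₂ g₁ (UnionOfImages-swap g₁ g₂ union) g₂⊆facetᶜ g₁⊆facet b≤2ⁿ⁺¹
mI≡⊓ {a = a} {b} g₁ g₂ j false union g₁⊆facet g₂⊆facetᶜ a≤2ⁿ⁺¹ b≤2ⁿ⁺¹ =
  trans ones≡b (sym (m≥n⇒m⊓n≡n (subst₂ _≤_ ones≡b zeros≡a (count-ones≤count-zeros (a + b) j))))
  where
  ones≡b : count _ (segmentFacet (a + b) j true) ≡ b
  ones≡b = count-segmentFacet g₂ g₁ (UnionOfImages-swap g₁ g₂ union) g₂⊆facetᶜ g₁⊆facet b≤2ⁿ⁺¹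
  zeros≡a : count _ (segmentFacet (a + b) j false) ≡ a
  zeros≡a = count-segmentFacet g₁ g₂ union g₁⊆facet g₂⊆facetᶜ a≤2ⁿ⁺¹

fit⇒mI≡⊓ : ∀ {n a b} → 2 ^ n + 2 ^ (n ∸ 1) < a + b → a ≤ 2 ^ n → b ≤ 2 ^ n → Fit n a b →
  Σ (Fin (suc n)) λ j → mI n (a + b) j ≡ a ⊓ b
fit⇒mI≡⊓ {n} long a≤2ⁿ b≤2ⁿ (_ , _ , _ , g₁ , g₂ , union)
  with j , ε , g₁⊆facet ← image⊆facet g₁ a≤2ⁿ
     | j′ , ε′ , g₂⊆facetᶜ ← image⊆facet g₂ b≤2ⁿ
  with refl , refl ← segment⊆facets⇒complementary long
         (λ y y∈I → Sum.map (g₁⊆facet y) (g₂⊆facetᶜ y) (Equivalence.from (union y) y∈I))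
  = j , mI≡⊓ g₁ g₂ j ε union g₁⊆facet g₂⊆facetᶜ (≤-trans a≤2ⁿ 2ⁿ≤2ⁿ⁺¹) (≤-trans b≤2ⁿ 2ⁿ≤2ⁿ⁺¹)
  where
  2ⁿ≤2ⁿ⁺¹ : 2 ^ n ≤ 2 ^ suc n
  2ⁿ≤2ⁿ⁺¹ = m≤m+n (2 ^ n) _

2[2p]≡3p+p : ∀ p → 2 * (2 * p) ≡ 3 * p + p
2[2p]≡3p+p = solve-∀

2[2p]+2p≡3p+3p : ∀ p → 2 * (2 * p) + 2 * p ≡ 3 * p + 3 * p
2[2p]+2p≡3p+3p = solve-∀

S′-sum-bound : ∀ m {a b} → 2 ^ (2 + m) ∸ 2 ^ m < a → 2 ^ (2 + m) ∸ 2 ^ m < b →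
  2 ^ (2 + m) + 2 ^ (1 + m) < a + b
S′-sum-bound m {a} {b} a>3p b>3p = begin-strict
  2 ^ (2 + m) + 2 ^ (1 + m)                   ≡⟨ 2[2p]+2p≡3p+3p p ⟩
  3 * p + 3 * p                               ≡⟨ cong₂ _+_ 4p∸p≡3p 4p∸p≡3p ⟨
  (2 ^ (2 + m) ∸ p) + (2 ^ (2 + m) ∸ p)       <⟨ +-mono-< a>3p b>3p ⟩
  a + b                                       ∎
  where
  open ≤-Reasoning
  p = 2 ^ m
  4p∸p≡3p : 2 ^ (2 + m) ∸ p ≡ 3 * p
  4p∸p≡3p = trans (cong (_∸ p) (2[2p]≡3p+p p)) (m+n∸n≡m (3 * p) p)

mainTheorem19 : (n a b : ℕ) → 2 ≤ n →
    2 ^ n ∸ 2 ^ (n ∸ 2) < a → a < 2 ^ n →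
    2 ^ n ∸ 2 ^ (n ∸ 2) < b → b < 2 ^ n →
    (a + 2 ≤ b ⊎ b + 2 ≤ a) →
    Fit n a b →
    Σ (Fin (suc n)) λ j → mI n (a + b) j ≡ a ⊓ b
mainTheorem19 (suc (suc m)) a b (s≤s (s≤s z≤n)) a>S a<2ⁿ b>S b<2ⁿ _ fit =
  fit⇒mI≡⊓ (S′-sum-bound m a>S b>S) (<⇒≤ a<2ⁿ) (<⇒≤ b<2ⁿ) fit
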